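{- Let $\mathcal{W}^{<>}$ be the set of Dyck paths whose sequence of valley heights (read left to right) is strictly unimodal. Then $$\sum_{D\in\mathcal{W}^{<>}}z^{|D|}=\frac{1-3z+2z^2-z^3}{(1-z)(1-3z+z^2)},$$ where $|D|$ is the semilength of $D$.
   Context: A Dyck path of semilength $n$ is a lattice path with steps $\mathbf{u}=(1,1)$ and $\mathbf{d}=(1,-1)$ from $(0,0)$ to $(2n,0)$ never going below the $x$-axis. A valley is an occurrence of consecutive steps $\mathbf{du}$; its height is the $y$-coordinate of its lowest vertex. A sequence $a_1,\dots,a_k$ is strictly unimodal if there is $j$ with $1\le j\le k$ and $a_1<a_2<\dots<a_j>a_{j+1}>\dots>a_k$; the empty sequence (paths with no valleys) counts as unimodal. -}

module Defs where

open import Data.Bool using (Bool; true; false; _∧_; if_then_else_)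
open import Data.Nat using (ℕ; zero; suc; _∸_; _*_; _<ᵇ_; _≡ᵇ_)
open import Data.Integer using (ℤ; +_; -[1+_])
import Data.Integer as ℤ
open import Data.List using (List; []; _∷_; _++_; map; concatMap; length; filterᵇ; sum)

-- Steps of a lattice path: u = (1,1), d = (1,-1)
data Step : Set where
  u d : Step

words : ℕ → List (List Step)
words zero = [] ∷ []
words (suc m) = concatMap (λ w → (u ∷ w) ∷ (d ∷ w) ∷ []) (words m)

dyckFrom : ℕ → List Step → Bool
dyckFrom h [] = h ≡ᵇ 0
dyckFrom h (u ∷ s) = dyckFrom (suc h) s
dyckFrom zero (d ∷ s) = false
dyckFrom (suc h) (d ∷ s) = dyckFrom h s

isDyck : List Step → Bool
isDyck = dyckFrom 0

-- Heights of valleys (occurrences of d u), read left to right, starting from height h.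
-- The height of a valley is the y-coordinate of its lowest vertex (after the d step).
valleysFrom : ℕ → List Step → List ℕ
valleysFrom h [] = []
valleysFrom h (u ∷ s) = valleysFrom (suc h) s
valleysFrom h (d ∷ u ∷ s) = (h ∸ 1) ∷ valleysFrom (h ∸ 1) (u ∷ s)
valleysFrom h (d ∷ s) = valleysFrom (h ∸ 1) s

valleyHeights : List Step → List ℕ
valleyHeights = valleysFrom 0

descending : ℕ → List ℕ → Bool
descending prev [] = true
descending prev (x ∷ xs) = (x <ᵇ prev) ∧ descending x xs

ascending : ℕ → List ℕ → Bool
ascending prev [] = true
ascending prev (x ∷ xs) = if prev <ᵇ x then ascending x xs else descending prev (x ∷ xs)

strictlyUnimodal : List ℕ → Bool
strictlyUnimodal [] = true
strictlyUnimodal (x ∷ xs) = ascending x xs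

-- w n = number of Dyck paths of semilength n with strictly unimodal valley heights
-- (= coefficient of z^n in the generating function of W^{<>})
w : ℕ → ℕ
w n = length (filterᵇ (λ p → isDyck p ∧ strictlyUnimodal (valleyHeights p)) (words (2 * n)))

-- Polynomials with integer coefficients as coefficient lists (constant term first)
Poly : Set
Poly = List ℤ

scale : ℤ → Poly → Poly
scale c = map (c ℤ.*_)

addP : Poly → Poly → Poly
addP [] q = q
addP p [] = p
addP (a ∷ p) (b ∷ q) = (a ℤ.+ b) ∷ addP p q

mulP : Poly → Poly → Poly
mulP [] q = []
mulP (a ∷ p) q = addP (scale a q) (+ 0 ∷ mulP p q)

coeff : Poly → ℕ → ℤ
coeff [] n = + 0
coeff (a ∷ p) zero = a
coeff (a ∷ p) (suc n) = coeff p n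

-- coefficient of z^n in P(z) * F(z), where F(z) = Σ f(k) z^k is a formal power series
coeffMul : Poly → (ℕ → ℤ) → ℕ → ℤ
coeffMul [] f n = + 0
coeffMul (a ∷ p) f zero = a ℤ.* f zero
coeffMul (a ∷ p) f (suc n) = a ℤ.* f (suc n) ℤ.+ coeffMul p f n

numerator : Poly
numerator = + 1 ∷ -[1+ 2 ] ∷ + 2 ∷ -[1+ 0 ] ∷ []

denominator : Poly
denominator = mulP (+ 1 ∷ -[1+ 0 ] ∷ []) (+ 1 ∷ -[1+ 2 ] ∷ + 1 ∷ [])

-- Strict unimodality is recognised by a reader of the valley sequence that
-- remembers the last valley height and whether the sequence is still rising.
-- Counting Dyck suffixes by remaining length, current height, state of the
-- reader and whether the last step was d gives a transfer recursion whose value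
-- at length 2n, height 0 and the initial state is w n.  Raising a path by one
-- unit raises all its valley heights, which yields a Pascal-type recursion for
-- every state after the first valley; in the state falling 0 no further valley
-- is possible, so that count is explicit.  Induction on the length then gives
-- linear relations between the counts which at height 0 amount to
-- w (n+3) - 3 w (n+2) + w (n+1) = -1, and the difference of two consecutive
-- instances is the coefficient of z^(n+4) in (1 - z)(1 - 3z + z²) Σ w n zⁿ.
module Submission where

open import Algebra.Properties.CommutativeSemigroup using (interchange)
open import Data.Bool using (Bool; true; false; _∧_; if_then_else_)
open import Data.Integer using (ℤ; +_; -[1+_])
import Data.Integer as ℤ
open import Data.Integer.Properties using (pos-*)
import Data.Integer.Tactic.RingSolver as ℤ-Solver
open import Data.List using (List; []; _∷_; concatMap; length; filterᵇ)
open import Data.Nat using (ℕ; zero; suc; _+_; _*_; _<ᵇ_; _≡ᵇ_)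
open import Data.Nat.Properties using (+-assoc; +-identityʳ; *-suc; *-distribˡ-+; +-commutativeSemigroup)
open import Data.Nat.Tactic.RingSolver using (solve-∀)
open import Relation.Binary.PropositionalEquality
  using (_≡_; refl; sym; trans; cong; cong₂; module ≡-Reasoning)

open import Defs

open ≡-Reasoning

+-interchange : ∀ a b c d → (a + b) + (c + d) ≡ (a + c) + (b + d)
+-interchange = interchange +-commutativeSemigroup

+-pairwise : ∀ {a b c e a′ b′ c′ e′} → a + c ≡ a′ + c′ → b + e ≡ b′ + e′ →
  (a + b) + (c + e) ≡ (a′ + b′) + (c′ + e′)
+-pairwise {a} {b} {c} {e} {a′} {b′} {c′} {e′} p q = begin
  (a + b) + (c + e)       ≡⟨ +-interchange a b c e ⟩
  (a + c) + (b + e)       ≡⟨ cong₂ _+_ p q ⟩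
  (a′ + c′) + (b′ + e′)   ≡⟨ +-interchange a′ c′ b′ e′ ⟩
  (a′ + b′) + (c′ + e′)   ∎

+-pairwise₃ : ∀ {a₁ a₂ a₃ b₁ b₂ b₃ c₁ c₂ c₃ e₁ e₂ e₃} →
  (a₁ + a₂) + a₃ ≡ (b₁ + b₂) + b₃ → (c₁ + c₂) + c₃ ≡ (e₁ + e₂) + e₃ →
  ((a₁ + c₁) + (a₂ + c₂)) + (a₃ + c₃) ≡ ((b₁ + e₁) + (b₂ + e₂)) + (b₃ + e₃)
+-pairwise₃ {a₁} {a₂} {a₃} {b₁} {b₂} {b₃} {c₁} {c₂} {c₃} {e₁} {e₂} {e₃} p q = begin
  ((a₁ + c₁) + (a₂ + c₂)) + (a₃ + c₃)  ≡⟨ regroup a₁ c₁ a₂ c₂ a₃ c₃ ⟩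
  ((a₁ + a₂) + a₃) + ((c₁ + c₂) + c₃)  ≡⟨ cong₂ _+_ p q ⟩
  ((b₁ + b₂) + b₃) + ((e₁ + e₂) + e₃)  ≡⟨ regroup b₁ e₁ b₂ e₂ b₃ e₃ ⟨
  ((b₁ + e₁) + (b₂ + e₂)) + (b₃ + e₃)  ∎
  where
  regroup : ∀ a₁ c₁ a₂ c₂ a₃ c₃ → ((a₁ + c₁) + (a₂ + c₂)) + (a₃ + c₃) ≡ ((a₁ + a₂) + a₃) + ((c₁ + c₂) + c₃)
  regroup = solve-∀

data Phase : Set where
  start : Phase
  rising falling : ℕ → Phase
  rejected : Phase

feed : Phase → ℕ → Phase
feed start x = rising x
feed (rising p) x = if p <ᵇ x then rising x else (if x <ᵇ p then falling x else rejected)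
feed (falling p) x = if x <ᵇ p then falling x else rejected
feed rejected x = rejected

live : Phase → Bool
live rejected = false
live _ = true

accepts : Phase → List ℕ → Bool
accepts start = strictlyUnimodal
accepts (rising p) = ascending p
accepts (falling p) = descending p
accepts rejected _ = false

accepts-[] : ∀ ph → accepts ph [] ≡ live ph
accepts-[] start = refl
accepts-[] (rising p) = refl
accepts-[] (falling p) = refl
accepts-[] rejected = refl

accepts-∷ : ∀ ph x xs → accepts ph (x ∷ xs) ≡ accepts (feed ph x) xs
accepts-∷ start x xs = refl
accepts-∷ (rising p) x xs with p <ᵇ x
... | true = refl
... | false with x <ᵇ p
...   | true = refl
...   | false = refl
accepts-∷ (falling p) x xs with x <ᵇ p
... | true = refl
... | false = refl
accepts-∷ rejected x xs = refl

feedIf : Bool → Phase → ℕ → Phase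
feedIf true = feed
feedIf false ph _ = ph

-- After a d step, an initial u of s closes a valley at height h.
valleysAfterDown : ℕ → List Step → List ℕ
valleysAfterDown h (u ∷ s) = h ∷ valleysFrom h (u ∷ s)
valleysAfterDown h s = valleysFrom h s

valleysFrom-d : ∀ h s → valleysFrom (suc h) (d ∷ s) ≡ valleysAfterDown h s
valleysFrom-d h [] = refl
valleysFrom-d h (u ∷ s) = refl
valleysFrom-d h (d ∷ s) = refl

accepted : ℕ → Phase → Bool → List Step → Bool
accepted h ph b [] = (h ≡ᵇ 0) ∧ live ph
accepted h ph b (u ∷ s) = accepted (suc h) (feedIf b ph h) false s
accepted zero ph b (d ∷ s) = false
accepted (suc h) ph b (d ∷ s) = accepted h ph true s

mutual
  accepted-correct : ∀ h ph s → dyckFrom h s ∧ accepts ph (valleysFrom h s) ≡ accepted h ph false s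
  accepted-correct h ph [] = cong ((h ≡ᵇ 0) ∧_) (accepts-[] ph)
  accepted-correct h ph (u ∷ s) = accepted-correct (suc h) ph s
  accepted-correct zero ph (d ∷ s) = refl
  accepted-correct (suc h) ph (d ∷ s) =
    trans (cong (λ vs → dyckFrom h s ∧ accepts ph vs) (valleysFrom-d h s))
          (accepted-correct-afterDown h ph s)

  accepted-correct-afterDown : ∀ h ph s →
    dyckFrom h s ∧ accepts ph (valleysAfterDown h s) ≡ accepted h ph true s
  accepted-correct-afterDown h ph [] = cong ((h ≡ᵇ 0) ∧_) (accepts-[] ph)
  accepted-correct-afterDown h ph (u ∷ s) =
    trans (cong (dyckFrom (suc h) s ∧_) (accepts-∷ ph h (valleysFrom (suc h) s)))
          (accepted-correct (suc h) (feed ph h) s)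
  accepted-correct-afterDown zero ph (d ∷ s) = refl
  accepted-correct-afterDown (suc h) ph (d ∷ s) =
    trans (cong (λ vs → dyckFrom h s ∧ accepts ph vs) (valleysFrom-d h s))
          (accepted-correct-afterDown h ph s)

fromBool : Bool → ℕ
fromBool true = 1
fromBool false = 0

countᵇ : {A : Set} → (A → Bool) → List A → ℕ
countᵇ P xs = length (filterᵇ P xs)

countᵇ-∷ : {A : Set} (P : A → Bool) (x : A) (xs : List A) → countᵇ P (x ∷ xs) ≡ fromBool (P x) + countᵇ P xs
countᵇ-∷ P x xs with P x
... | true = refl
... | false = refl

countᵇ-cong : {A : Set} {P Q : A → Bool} → (∀ x → P x ≡ Q x) → (xs : List A) → countᵇ P xs ≡ countᵇ Q xs
countᵇ-cong P≗Q [] = refl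
countᵇ-cong {P = P} {Q} P≗Q (x ∷ xs) = begin
  countᵇ P (x ∷ xs)               ≡⟨ countᵇ-∷ P x xs ⟩
  fromBool (P x) + countᵇ P xs    ≡⟨ cong₂ _+_ (cong fromBool (P≗Q x)) (countᵇ-cong P≗Q xs) ⟩
  fromBool (Q x) + countᵇ Q xs    ≡⟨ countᵇ-∷ Q x xs ⟨
  countᵇ Q (x ∷ xs)               ∎

countᵇ-prepend : (P : List Step → Bool) (ws : List (List Step)) →
  countᵇ P (concatMap (λ s → (u ∷ s) ∷ (d ∷ s) ∷ []) ws) ≡ countᵇ (λ s → P (u ∷ s)) ws + countᵇ (λ s → P (d ∷ s)) ws
countᵇ-prepend P [] = refl
countᵇ-prepend P (s ∷ ws) = begin
  countᵇ P ((u ∷ s) ∷ (d ∷ s) ∷ rest)  ≡⟨ countᵇ-∷ P (u ∷ s) _ ⟩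
  pu + countᵇ P ((d ∷ s) ∷ rest)        ≡⟨ cong (λ x → pu + x) (countᵇ-∷ P (d ∷ s) rest) ⟩
  pu + (pd + countᵇ P rest)             ≡⟨ cong (λ c → pu + (pd + c)) (countᵇ-prepend P ws) ⟩
  pu + (pd + (cu + cd))                 ≡⟨ +-assoc pu pd (cu + cd) ⟨
  (pu + pd) + (cu + cd)                 ≡⟨ +-interchange pu pd cu cd ⟩
  (pu + cu) + (pd + cd)                 ≡⟨ cong₂ _+_ (countᵇ-∷ (λ t → P (u ∷ t)) s ws) (countᵇ-∷ (λ t → P (d ∷ t)) s ws) ⟨
  countᵇ (λ t → P (u ∷ t)) (s ∷ ws) + countᵇ (λ t → P (d ∷ t)) (s ∷ ws) ∎
  where
  rest = concatMap (λ t → (u ∷ t) ∷ (d ∷ t) ∷ []) ws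
  pu = fromBool (P (u ∷ s))
  pd = fromBool (P (d ∷ s))
  cu = countᵇ (λ t → P (u ∷ t)) ws
  cd = countᵇ (λ t → P (d ∷ t)) ws

paths : ℕ → ℕ → Phase → Bool → ℕ
paths zero h ph b = fromBool ((h ≡ᵇ 0) ∧ live ph)
paths (suc m) zero ph b = paths m 1 (feedIf b ph 0) false
paths (suc m) (suc h) ph b = paths m (suc (suc h)) (feedIf b ph (suc h)) false + paths m h ph true

countᵇ-accepted : ∀ m h ph b → countᵇ (accepted h ph b) (words m) ≡ paths m h ph b
countᵇ-accepted zero h ph b with (h ≡ᵇ 0) ∧ live ph
... | true = refl
... | false = refl
countᵇ-accepted (suc m) zero ph b = begin
  countᵇ (accepted 0 ph b) (words (suc m))
    ≡⟨ countᵇ-prepend (accepted 0 ph b) (words m) ⟩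
  countᵇ (accepted 1 (feedIf b ph 0) false) (words m) + countᵇ (λ _ → false) (words m)
    ≡⟨ cong₂ _+_ (countᵇ-accepted m 1 (feedIf b ph 0) false) (countᵇ-false (words m)) ⟩
  paths m 1 (feedIf b ph 0) false + 0
    ≡⟨ +-identityʳ _ ⟩
  paths m 1 (feedIf b ph 0) false ∎
  where
  countᵇ-false : (ws : List (List Step)) → countᵇ (λ _ → false) ws ≡ 0
  countᵇ-false [] = refl
  countᵇ-false (_ ∷ ws) = countᵇ-false ws
countᵇ-accepted (suc m) (suc h) ph b =
  trans (countᵇ-prepend (accepted (suc h) ph b) (words m))
        (cong₂ _+_ (countᵇ-accepted m (suc (suc h)) (feedIf b ph (suc h)) false) (countᵇ-accepted m h ph true))

w≡paths : ∀ n → w n ≡ paths (2 * n) 0 start false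
w≡paths n = trans (countᵇ-cong (accepted-correct 0 start) (words (2 * n)))
                  (countᵇ-accepted (2 * n) 0 start false)

paths-rejected : ∀ m h b → paths m h rejected b ≡ 0
paths-rejected zero zero b = refl
paths-rejected zero (suc h) b = refl
paths-rejected (suc m) zero false = paths-rejected m 1 false
paths-rejected (suc m) zero true = paths-rejected m 1 false
paths-rejected (suc m) (suc h) false = cong₂ _+_ (paths-rejected m (suc (suc h)) false) (paths-rejected m h true)
paths-rejected (suc m) (suc h) true = cong₂ _+_ (paths-rejected m (suc (suc h)) false) (paths-rejected m h true)

-- Number of valley-free paths uᵏ dᵏ⁺ʰ of length m from height h down to 0.
valleyFree : ℕ → ℕ → ℕ
valleyFree zero zero = 1
valleyFree zero (suc h) = 0
valleyFree (suc m) (suc h) = valleyFree m h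
valleyFree (suc zero) zero = 0
valleyFree (suc (suc m)) zero = valleyFree m zero

valleyFree-1+ : ∀ m → valleyFree m 1 ≡ valleyFree (suc m) 0
valleyFree-1+ zero = refl
valleyFree-1+ (suc m) = refl

valleyFree-up-or-down : ∀ m h → valleyFree m h ≡ valleyFree m (suc (suc h)) + fromBool (m ≡ᵇ h)
valleyFree-up-or-down zero zero = refl
valleyFree-up-or-down zero (suc h) = refl
valleyFree-up-or-down (suc m) zero = sym (trans (+-identityʳ _) (valleyFree-1+ m))
valleyFree-up-or-down (suc m) (suc h) = valleyFree-up-or-down m h

paths-falling0-afterDown : ∀ m h → paths m h (falling 0) true ≡ fromBool (m ≡ᵇ h)
paths-falling0-afterDown zero zero = refl
paths-falling0-afterDown zero (suc h) = refl
paths-falling0-afterDown (suc m) zero = paths-rejected m 1 false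
paths-falling0-afterDown (suc m) (suc h) =
  cong₂ _+_ (paths-rejected m (suc (suc h)) false) (paths-falling0-afterDown m h)

paths-falling0 : ∀ m h → paths m h (falling 0) false ≡ valleyFree m h
paths-falling0 zero zero = refl
paths-falling0 zero (suc h) = refl
paths-falling0 (suc m) zero = trans (paths-falling0 m 1) (valleyFree-1+ m)
paths-falling0 (suc m) (suc h) =
  trans (cong₂ _+_ (paths-falling0 m (suc (suc h))) (paths-falling0-afterDown m h))
        (sym (valleyFree-up-or-down m h))

paths-falling0-period : ∀ k → paths (2 + k) 1 (falling 0) false ≡ paths k 1 (falling 0) false
paths-falling0-period k = begin
  paths (2 + k) 1 (falling 0) false  ≡⟨ paths-falling0 (2 + k) 1 ⟩
  valleyFree (1 + k) 0              ≡⟨ valleyFree-1+ k ⟨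
  valleyFree k 1                    ≡⟨ paths-falling0 k 1 ⟨
  paths k 1 (falling 0) false       ∎

shift : Phase → Phase
shift start = start
shift (rising p) = rising (suc p)
shift (falling p) = falling (suc p)
shift rejected = rejected

data Started : Phase → Set where
  rising : ∀ p → Started (rising p)
  falling : ∀ p → Started (falling p)
  rejected : Started rejected

feed-started : ∀ ph x → Started (feed ph x)
feed-started start x = rising x
feed-started (rising p) x with p <ᵇ x
... | true = rising x
... | false with x <ᵇ p
...   | true = falling x
...   | false = rejected
feed-started (falling p) x with x <ᵇ p
... | true = falling x
... | false = rejected
feed-started rejected x = rejected

feedIf-started : ∀ b ph x → Started ph → Started (feedIf b ph x)
feedIf-started true ph x _ = feed-started ph x
feedIf-started false ph x s = s

feed-shift : ∀ ph x → feed (shift ph) (suc x) ≡ shift (feed ph x)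
feed-shift start x = refl
feed-shift (rising p) x with p <ᵇ x
... | true = refl
... | false with x <ᵇ p
...   | true = refl
...   | false = refl
feed-shift (falling p) x with x <ᵇ p
... | true = refl
... | false = refl
feed-shift rejected x = refl

feedIf-shift : ∀ b ph x → feedIf b (shift ph) (suc x) ≡ shift (feedIf b ph x)
feedIf-shift true = feed-shift
feedIf-shift false ph x = refl

-- A valley at height 0 sends every shifted phase to falling 0 or rejected.
paths-shift-ground : ∀ k ph → Started ph → paths (2 + k) 0 (shift ph) true ≡ paths k 0 (shift ph) true
paths-shift-ground zero _ (rising p) = refl
paths-shift-ground zero _ (falling p) = refl
paths-shift-ground zero _ rejected = refl
paths-shift-ground (suc k) _ (rising p) = paths-falling0-period k
paths-shift-ground (suc k) _ (falling p) = paths-shift-ground (suc k) _ (rising p)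
paths-shift-ground (suc k) _ rejected = trans (paths-rejected (3 + k) 0 true) (sym (paths-rejected (1 + k) 0 true))

paths-shift : ∀ m h ph b → Started ph →
  paths (2 + m) (1 + h) (shift ph) b ≡ paths (1 + m) h ph b + paths m (1 + h) (shift ph) b
paths-shift zero zero ph b s = refl
paths-shift zero (suc zero) _ b (rising p) = refl
paths-shift zero (suc zero) _ b (falling p) = refl
paths-shift zero (suc zero) _ b rejected = refl
paths-shift zero (suc (suc h)) ph b s = refl
paths-shift (suc k) h ph b s = byHeight h
  where
  afterUp : ∀ h → paths (2 + k) (2 + h) (feedIf b (shift ph) (1 + h)) false
                ≡ paths (1 + k) (1 + h) (feedIf b ph h) false + paths k (2 + h) (feedIf b (shift ph) (1 + h)) false
  afterUp h rewrite feedIf-shift b ph h = paths-shift k (1 + h) (feedIf b ph h) false (feedIf-started b ph h s)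

  byHeight : ∀ h → paths (3 + k) (1 + h) (shift ph) b ≡ paths (2 + k) h ph b + paths (1 + k) (1 + h) (shift ph) b
  byHeight zero =
    trans (cong₂ _+_ (afterUp 0) (paths-shift-ground k ph s))
          (+-assoc (paths (1 + k) 1 (feedIf b ph 0) false) (paths k 2 (feedIf b (shift ph) 1) false)
                   (paths k 0 (shift ph) true))
  byHeight (suc h) =
    trans (cong₂ _+_ (afterUp (1 + h)) (paths-shift k h ph true s))
          (+-interchange (paths (1 + k) (2 + h) (feedIf b ph (1 + h)) false)
                         (paths k (3 + h) (feedIf b (shift ph) (2 + h)) false)
                         (paths (1 + k) h ph true) (paths k (1 + h) (shift ph) true))

paths-rising0-recurrence : ∀ m h b →
  paths (3 + m) (1 + h) (rising 0) b + paths m h (falling 0) b ≡ paths (2 + m) h start b + paths (1 + m) (1 + h) (rising 0) b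
paths-rising0-recurrence zero zero false = refl
paths-rising0-recurrence zero zero true = refl
paths-rising0-recurrence zero (suc zero) false = refl
paths-rising0-recurrence zero (suc zero) true = refl
paths-rising0-recurrence zero (suc (suc zero)) false = refl
paths-rising0-recurrence zero (suc (suc zero)) true = refl
paths-rising0-recurrence zero (suc (suc (suc h))) false = refl
paths-rising0-recurrence zero (suc (suc (suc h))) true = refl
paths-rising0-recurrence (suc k) h b = byHeight h
  where
  afterUp : ∀ b h →
    paths (3 + k) (2 + h) (feedIf b (rising 0) (1 + h)) false + paths k (1 + h) (feedIf b (falling 0) h) false
    ≡ paths (2 + k) (1 + h) (feedIf b start h) false + paths (1 + k) (2 + h) (feedIf b (rising 0) (1 + h)) false
  afterUp false h = paths-rising0-recurrence k (1 + h) false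
  afterUp true h = begin
    paths (3 + k) (2 + h) (rising (1 + h)) false + paths k (1 + h) rejected false
      ≡⟨ cong (λ x → paths (3 + k) (2 + h) (rising (1 + h)) false + x) (paths-rejected k (1 + h) false) ⟩
    paths (3 + k) (2 + h) (rising (1 + h)) false + 0
      ≡⟨ +-identityʳ _ ⟩
    paths (3 + k) (2 + h) (rising (1 + h)) false
      ≡⟨ paths-shift (1 + k) (1 + h) (rising h) false (rising h) ⟩
    paths (2 + k) (1 + h) (rising h) false + paths (1 + k) (2 + h) (rising (1 + h)) false ∎

  byHeight : ∀ h →
    paths (4 + k) (1 + h) (rising 0) b + paths (1 + k) h (falling 0) b
    ≡ paths (3 + k) h start b + paths (2 + k) (1 + h) (rising 0) b
  byHeight zero = begin
    (u₁ + paths (3 + k) 0 (rising 0) true) + u₂  ≡⟨ cong (λ x → (u₁ + x) + u₂) (paths-rejected (2 + k) 1 false) ⟩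
    (u₁ + 0) + u₂                                ≡⟨ cong (λ x → x + u₂) (+-identityʳ u₁) ⟩
    u₁ + u₂                                      ≡⟨ afterUp b 0 ⟩
    u₃ + u₄                                      ≡⟨ cong (λ x → u₃ + x) (+-identityʳ u₄) ⟨
    u₃ + (u₄ + 0)                                ≡⟨ cong (λ x → u₃ + (u₄ + x)) (paths-rejected k 1 false) ⟨
    u₃ + (u₄ + paths (1 + k) 0 (rising 0) true)  ∎
    where
    u₁ = paths (3 + k) 2 (feedIf b (rising 0) 1) false
    u₂ = paths k 1 (feedIf b (falling 0) 0) false
    u₃ = paths (2 + k) 1 (feedIf b start 0) false
    u₄ = paths (1 + k) 2 (feedIf b (rising 0) 1) false
  byHeight (suc h) =
    +-pairwise {u₁} {d₁} {u₂} {d₂} {u₃} {d₃} {u₄} {d₄} (afterUp b (1 + h)) (paths-rising0-recurrence k h true)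
    where
    u₁ = paths (3 + k) (3 + h) (feedIf b (rising 0) (2 + h)) false
    u₂ = paths k (2 + h) (feedIf b (falling 0) (1 + h)) false
    u₃ = paths (2 + k) (2 + h) (feedIf b start (1 + h)) false
    u₄ = paths (1 + k) (3 + h) (feedIf b (rising 0) (2 + h)) false
    d₁ = paths (3 + k) (1 + h) (rising 0) true
    d₂ = paths k h (falling 0) true
    d₃ = paths (2 + k) h start true
    d₄ = paths (1 + k) (1 + h) (rising 0) true

paths-start-afterDown-ground : ∀ k →
  paths (3 + k) 1 start true + paths k 0 start true
  ≡ (paths (2 + k) 0 start true + paths (2 + k) 0 start true) + paths (1 + k) 1 start true
paths-start-afterDown-ground k = begin
  (paths (2 + k) 2 (rising 1) false + a) + s  ≡⟨ cong (λ x → (x + a) + s) (paths-shift k 1 (rising 0) false (rising 0)) ⟩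
  ((a + q) + a) + s                            ≡⟨ regroup a q s ⟩
  (a + a) + (q + s)                            ∎
  where
  a = paths (1 + k) 1 (rising 0) false
  q = paths k 2 (rising 1) false
  s = paths k 0 start true
  regroup : ∀ a q s → ((a + q) + a) + s ≡ (a + a) + (q + s)
  regroup = solve-∀

paths-start-recurrence : ∀ m h b →
  (paths (3 + m) (2 + h) start b + paths (1 + m) h start b) + paths m (1 + h) start b
  ≡ (paths (2 + m) (1 + h) start b + paths (2 + m) (1 + h) start b) + paths (1 + m) (2 + h) start b
paths-start-recurrence zero zero false = refl
paths-start-recurrence zero zero true = refl
paths-start-recurrence zero (suc zero) false = refl
paths-start-recurrence zero (suc zero) true = refl
paths-start-recurrence zero (suc (suc h)) false = refl
paths-start-recurrence zero (suc (suc h)) true = refl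
paths-start-recurrence (suc k) h b = byHeight h
  where
  afterUp : ∀ b h →
    (paths (3 + k) (3 + h) (feedIf b start (2 + h)) false + paths (1 + k) (1 + h) (feedIf b start h) false)
      + paths k (2 + h) (feedIf b start (1 + h)) false
    ≡ (paths (2 + k) (2 + h) (feedIf b start (1 + h)) false + paths (2 + k) (2 + h) (feedIf b start (1 + h)) false)
      + paths (1 + k) (3 + h) (feedIf b start (2 + h)) false
  afterUp false h = paths-start-recurrence k (1 + h) false
  afterUp true h = begin
    (paths (3 + k) (3 + h) (rising (2 + h)) false + u₂) + u₃
      ≡⟨ cong (λ x → (x + u₂) + u₃) (paths-shift (1 + k) (2 + h) (rising (1 + h)) false (rising (1 + h))) ⟩
    ((r₁ + r₂) + u₂) + u₃
      ≡⟨ regroup r₁ r₂ u₂ u₃ ⟩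
    (r₁ + (u₂ + u₃)) + r₂
      ≡⟨ cong (λ x → (r₁ + x) + r₂) (paths-shift k (1 + h) (rising h) false (rising h)) ⟨
    (r₁ + r₁) + r₂ ∎
    where
    r₁ = paths (2 + k) (2 + h) (rising (1 + h)) false
    r₂ = paths (1 + k) (3 + h) (rising (2 + h)) false
    u₂ = paths (1 + k) (1 + h) (rising h) false
    u₃ = paths k (2 + h) (rising (1 + h)) false
    regroup : ∀ r₁ r₂ u₂ u₃ → ((r₁ + r₂) + u₂) + u₃ ≡ (r₁ + (u₂ + u₃)) + r₂
    regroup = solve-∀

  byHeight : ∀ h →
    (paths (4 + k) (2 + h) start b + paths (2 + k) h start b) + paths (1 + k) (1 + h) start b
    ≡ (paths (3 + k) (1 + h) start b + paths (3 + k) (1 + h) start b) + paths (2 + k) (2 + h) start b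
  byHeight zero = begin
    ((u₁ + d₁) + u₂) + (u₃ + d₃)
      ≡⟨ cong (λ x → ((u₁ + d₁) + x) + (u₃ + d₃)) (+-identityʳ u₂) ⟨
    ((u₁ + d₁) + (u₂ + 0)) + (u₃ + d₃)
      ≡⟨ +-pairwise₃ {u₁} {u₂} {u₃} {u₄} {u₄} {u₅} {d₁} {0} {d₃} {e₄} {e₄} {e₅}
           (afterUp b 0) (trans (cong (λ x → x + d₃) (+-identityʳ d₁)) (paths-start-afterDown-ground k)) ⟩
    ((u₄ + e₄) + (u₄ + e₄)) + (u₅ + e₅) ∎
    where
    u₁ = paths (3 + k) 3 (feedIf b start 2) false
    u₂ = paths (1 + k) 1 (feedIf b start 0) false
    u₃ = paths k 2 (feedIf b start 1) false
    u₄ = paths (2 + k) 2 (feedIf b start 1) false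
    u₅ = paths (1 + k) 3 (feedIf b start 2) false
    d₁ = paths (3 + k) 1 start true
    d₃ = paths k 0 start true
    e₄ = paths (2 + k) 0 start true
    e₅ = paths (1 + k) 1 start true
  byHeight (suc h) =
    +-pairwise₃ {u₁} {u₂} {u₃} {u₄} {u₄} {u₅} {d₁} {d₂} {d₃} {e₄} {e₄} {e₅} (afterUp b (1 + h)) (paths-start-recurrence k h true)
    where
    u₁ = paths (3 + k) (4 + h) (feedIf b start (3 + h)) false
    u₂ = paths (1 + k) (2 + h) (feedIf b start (1 + h)) false
    u₃ = paths k (3 + h) (feedIf b start (2 + h)) false
    u₄ = paths (2 + k) (3 + h) (feedIf b start (2 + h)) false
    u₅ = paths (1 + k) (4 + h) (feedIf b start (3 + h)) false
    d₁ = paths (3 + k) (2 + h) start true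
    d₂ = paths (1 + k) h start true
    d₃ = paths k (1 + h) start true
    e₄ = paths (2 + k) (1 + h) start true
    e₅ = paths (1 + k) (2 + h) start true

valleyFree-even : ∀ n → valleyFree (2 * n) 0 ≡ 1
valleyFree-even zero = refl
valleyFree-even (suc n) rewrite *-suc 2 n = valleyFree-even n

paths-ground-recurrence : ∀ j → valleyFree j 0 ≡ 1 →
  paths (6 + j) 0 start false + paths (2 + j) 0 start false + 1 ≡ 3 * paths (4 + j) 0 start false
paths-ground-recurrence j even = begin
  ((x + a₃) + W₂) + 1                              ≡⟨ regroup x a₃ W₂ 1 ⟩
  (x + W₂) + (a₃ + 1)                              ≡⟨ cong (λ c → (x + W₂) + (a₃ + c)) (trans (paths-falling0 j 0) even) ⟨
  (x + W₂) + (a₃ + paths j 0 (falling 0) false)    ≡⟨ cong (λ c → (x + W₂) + c) (paths-rising0-recurrence j 0 false) ⟩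
  (x + W₂) + (W₂ + a₁)                             ≡⟨ +-assoc (x + W₂) W₂ a₁ ⟨
  ((x + W₂) + W₂) + a₁                             ≡⟨ cong (λ c → c + a₁) (paths-start-recurrence (1 + j) 0 false) ⟩
  ((W₄ + W₄) + y) + a₁                             ≡⟨ +-assoc (W₄ + W₄) y a₁ ⟩
  (W₄ + W₄) + W₄                                   ≡⟨ triple W₄ ⟩
  3 * W₄                                           ∎
  where
  x = paths (4 + j) 2 start false
  y = paths (2 + j) 2 start false
  a₁ = paths (1 + j) 1 (rising 0) false
  a₃ = paths (3 + j) 1 (rising 0) false
  W₂ = paths (2 + j) 0 start false
  W₄ = paths (4 + j) 0 start false
  regroup : ∀ x a₃ W₂ c → ((x + a₃) + W₂) + c ≡ (x + W₂) + (a₃ + c)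
  regroup = solve-∀
  triple : ∀ c → (c + c) + c ≡ 3 * c
  triple = solve-∀

w-recurrence : ∀ n → w (3 + n) + w (1 + n) + 1 ≡ 3 * w (2 + n)
w-recurrence n = begin
  w (3 + n) + w (1 + n) + 1
    ≡⟨ cong₂ (λ x y → x + y + 1) (w≡paths-offset 3) (w≡paths-offset 1) ⟩
  paths (6 + 2 * n) 0 start false + paths (2 + 2 * n) 0 start false + 1
    ≡⟨ paths-ground-recurrence (2 * n) (valleyFree-even n) ⟩
  3 * paths (4 + 2 * n) 0 start false
    ≡⟨ cong (3 *_) (w≡paths-offset 2) ⟨
  3 * w (2 + n) ∎
  where
  w≡paths-offset : ∀ k → w (k + n) ≡ paths (2 * k + 2 * n) 0 start false
  w≡paths-offset k = trans (w≡paths (k + n)) (cong (λ m → paths m 0 start false) (*-distribˡ-+ 2 k n))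

coeffMul-denominator : (f : ℕ → ℤ) → (∀ n → f (3 + n) ℤ.+ f (1 + n) ℤ.+ + 1 ≡ + 3 ℤ.* f (2 + n)) →
  ∀ n → coeffMul denominator f (4 + n) ≡ + 0
coeffMul-denominator f rec n = begin
  coeffMul denominator f (4 + n)
    ≡⟨ difference-of-recurrences (f (1 + n)) (f (2 + n)) (f (3 + n)) (f (4 + n)) ⟩
  (f (4 + n) ℤ.+ f (2 + n) ℤ.+ + 1 ℤ.- + 3 ℤ.* f (3 + n)) ℤ.- (f (3 + n) ℤ.+ f (1 + n) ℤ.+ + 1 ℤ.- + 3 ℤ.* f (2 + n))
    ≡⟨ cong₂ (λ x y → (x ℤ.- + 3 ℤ.* f (3 + n)) ℤ.- (y ℤ.- + 3 ℤ.* f (2 + n))) (rec (1 + n)) (rec n) ⟩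
  (+ 3 ℤ.* f (3 + n) ℤ.- + 3 ℤ.* f (3 + n)) ℤ.- (+ 3 ℤ.* f (2 + n) ℤ.- + 3 ℤ.* f (2 + n))
    ≡⟨ cancel (+ 3 ℤ.* f (3 + n)) (+ 3 ℤ.* f (2 + n)) ⟩
  + 0 ∎
  where
  difference-of-recurrences : ∀ a b c e →
    + 1 ℤ.* e ℤ.+ (-[1+ 3 ] ℤ.* c ℤ.+ (+ 4 ℤ.* b ℤ.+ (-[1+ 0 ] ℤ.* a ℤ.+ + 0)))
    ≡ (e ℤ.+ b ℤ.+ + 1 ℤ.- + 3 ℤ.* c) ℤ.- (c ℤ.+ a ℤ.+ + 1 ℤ.- + 3 ℤ.* b)
  difference-of-recurrences = ℤ-Solver.solve-∀
  cancel : ∀ x y → (x ℤ.- x) ℤ.- (y ℤ.- y) ≡ + 0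
  cancel = ℤ-Solver.solve-∀

mainTheorem12 : (n : ℕ) → coeffMul denominator (λ k → + w k) n ≡ coeff numerator n
mainTheorem12 0 = refl
mainTheorem12 1 = refl
mainTheorem12 2 = refl
mainTheorem12 3 = refl
mainTheorem12 (suc (suc (suc (suc n)))) = coeffMul-denominator (λ k → + w k) w-recurrenceℤ n
  where
  w-recurrenceℤ : ∀ n → + w (3 + n) ℤ.+ + w (1 + n) ℤ.+ + 1 ≡ + 3 ℤ.* + w (2 + n)
  w-recurrenceℤ n = trans (cong +_ (w-recurrence n)) (pos-* 3 (w (2 + n)))
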